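{- Fix $n\geq 1$ and let $\varphi\in\mathrm{Form}_n$. Let $O(\varphi,n)$ be the set of assignments $\mu\colon\mathrm{Form}_n\to\{0,1\}$ such that $\mu(\varphi)=1$. Then there is a bijection between $O(\varphi,n)$ and the set of elements $g\in\mathbf{NM}^-_n$ that are minimal among the idempotent join-irreducible elements of $\mathbf{NM}^-_n$ and satisfy $g\le[\varphi]_\equiv$.
   Context: An NM algebra is an algebra $\langle A,\wedge,\vee,\odot,\to,\bot,\top\rangle$ such that $\langle A,\wedge,\vee,\bot,\top\rangle$ is a bounded lattice, $\langle A,\odot,\top\rangle$ is a commutative monoid, and: $x\odot y\le z$ iff $x\le y\to z$; $(x\to y)\vee(y\to x)=\top$; $\neg(x\odot y)\vee((x\wedge y)\to(x\odot y))=\top$; $\neg\neg x=x$, where $\neg x:=x\to\bot$. An NM$^-$ algebra is an NM algebra satisfying $\neg(\neg x^2)^2\leftrightarrow(\neg(\neg x)^2)^2=\top$, where $y^2=y\odot y$ and $a\leftrightarrow b=(a\to b)\odot(b\to a)$. Formulas are built from variables with $\odot,\wedge,\to,\bot$; $\mathrm{Form}_n$ is the set of formulas in variables $x_1,\dots,x_n$; here $\varphi\equiv\psi$ iff $\varphi\leftrightarrow\psi$ evaluates to $\top$ in every NM$^-$ algebra under every interpretation, and $\mathbf{NM}^-_n=\mathrm{Form}_n/\equiv$ is the free $n$-generated NM$^-$ algebra (finite, with distributive lattice reduct). An element $g$ is idempotent if $g\odot g=g$, and join-irreducible if it is not the bottom and $g=y\vee z$ implies $g=y$ or $g=z$. An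 assignment $\mu\colon\mathrm{Form}_n\to\{0,1\}$ is the evaluation map determined by values of $x_1,\dots,x_n$ in the two-element NM chain $\{0,1\}$ (with $\odot=\wedge=\min$, $\vee=\max$, $x\to y=1$ iff $x\le y$, $\bot=0$). -}

module Defs where

open import Level using (0ℓ)
open import Data.Nat using (ℕ)
open import Data.Fin using (Fin)
open import Data.Bool using (Bool; true; false; _∧_; _∨_; not)
open import Data.Product using (Σ; _×_; proj₁; proj₂; _,_)
open import Data.Sum using (_⊎_)
open import Relation.Nullary using (¬_)
open import Relation.Binary using (Setoid; IsEquivalence)
open import Relation.Binary.PropositionalEquality using (_≡_)
open import Algebra.Core using (Op₂)
open import Algebra.Structures using (IsCommutativeMonoid)
open import Algebra.Lattice.Structures using (IsLattice)

data Form (n : ℕ) : Set where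
  var  : Fin n → Form n
  _⊙f_ : Form n → Form n → Form n
  _∧f_ : Form n → Form n → Form n
  _⇒f_ : Form n → Form n → Form n
  ⊥f   : Form n

record NMAlgebra : Set₁ where
  infixr 6 _⊙_
  infixr 5 _⇒_
  field
    Carrier : Set
    _≈_     : Carrier → Carrier → Set
    _⊓_     : Op₂ Carrier
    _⊔_     : Op₂ Carrier
    _⊙_     : Op₂ Carrier
    _⇒_     : Op₂ Carrier
    ⊥ ⊤     : Carrier
    isLattice : IsLattice _≈_ _⊔_ _⊓_
    ⊥-least   : ∀ x → (⊥ ⊓ x) ≈ ⊥
    ⊤-greatest : ∀ x → (x ⊓ ⊤) ≈ x
    isCommMonoid : IsCommutativeMonoid _≈_ _⊙_ ⊤
    ⇒-cong : ∀ {x x′ y y′} → x ≈ x′ → y ≈ y′ → (x ⇒ y) ≈ (x′ ⇒ y′)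

  _≤_ : Carrier → Carrier → Set
  x ≤ y = (x ⊓ y) ≈ x

  ∼_ : Carrier → Carrier
  ∼ x = x ⇒ ⊥

  field
    residuation₁ : ∀ x y z → (x ⊙ y) ≤ z → x ≤ (y ⇒ z)
    residuation₂ : ∀ x y z → x ≤ (y ⇒ z) → (x ⊙ y) ≤ z
    prelinearity : ∀ x y → ((x ⇒ y) ⊔ (y ⇒ x)) ≈ ⊤
    nm-axiom     : ∀ x y → ((∼ (x ⊙ y)) ⊔ ((x ⊓ y) ⇒ (x ⊙ y))) ≈ ⊤
    involution   : ∀ x → (∼ (∼ x)) ≈ x

  _² : Carrier → Carrier
  y ² = y ⊙ y

  _⇔_ : Carrier → Carrier → Carrier
  a ⇔ b = (a ⇒ b) ⊙ (b ⇒ a)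

  ⟦_⟧ : ∀ {n} → Form n → (Fin n → Carrier) → Carrier
  ⟦ var i ⟧    ρ = ρ i
  ⟦ φ ⊙f ψ ⟧   ρ = ⟦ φ ⟧ ρ ⊙ ⟦ ψ ⟧ ρ
  ⟦ φ ∧f ψ ⟧   ρ = ⟦ φ ⟧ ρ ⊓ ⟦ ψ ⟧ ρ
  ⟦ φ ⇒f ψ ⟧   ρ = ⟦ φ ⟧ ρ ⇒ ⟦ ψ ⟧ ρ
  ⟦ ⊥f ⟧       ρ = ⊥

IsNM⁻ : NMAlgebra → Set
IsNM⁻ A = ∀ x → ((∼ ((∼ (x ²)) ²)) ⇔ ((∼ ((∼ x) ²)) ²)) ≈ ⊤
  where open NMAlgebra A

_≡NM_ : ∀ {n} → Form n → Form n → Set₁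
_≡NM_ {n} φ ψ = (A : NMAlgebra) → IsNM⁻ A → (ρ : Fin n → NMAlgebra.Carrier A) →
  let open NMAlgebra A in ((⟦ φ ⟧ ρ ⇒ ⟦ ψ ⟧ ρ) ⊙ (⟦ ψ ⟧ ρ ⇒ ⟦ φ ⟧ ρ)) ≈ ⊤

-- The free algebra NM⁻ₙ = Formₙ/≡ : elements are represented by formulas,
-- equality is ≡NM.  Its lattice order is [φ] ≤ [ψ] iff [φ ∧ ψ] = [φ].

_≤NM_ : ∀ {n} → Form n → Form n → Set₁
φ ≤NM ψ = (φ ∧f ψ) ≡NM φ

Idempotent : ∀ {n} → Form n → Set₁
Idempotent g = (g ⊙f g) ≡NM g

IsJoinOf : ∀ {n} → Form n → Form n → Form n → Set₁
IsJoinOf g y z = (y ≤NM g) × (z ≤NM g) × (∀ w → y ≤NM w → z ≤NM w → g ≤NM w)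

JoinIrreducible : ∀ {n} → Form n → Set₁
JoinIrreducible g = (¬ (g ≡NM ⊥f)) ×
  (∀ y z → IsJoinOf g y z → (g ≡NM y) ⊎ (g ≡NM z))

IdemJI : ∀ {n} → Form n → Set₁
IdemJI g = Idempotent g × JoinIrreducible g

MinIdemJI : ∀ {n} → Form n → Set₁
MinIdemJI g = IdemJI g × (∀ h → IdemJI h → h ≤NM g → h ≡NM g)

MinBelow : ∀ {n} → Form n → Set₁
MinBelow {n} φ = Σ (Form n) λ g → MinIdemJI g × (g ≤NM φ)

-- Assignments: evaluation in the two-element NM chain {0,1}
-- (0 = false, 1 = true; ⊙ = ∧ = min, x → y = 1 iff x ≤ y)

eval₂ : ∀ {n} → (Fin n → Bool) → Form n → Bool
eval₂ v (var i)   = v i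
eval₂ v (φ ⊙f ψ)  = eval₂ v φ ∧ eval₂ v ψ
eval₂ v (φ ∧f ψ)  = eval₂ v φ ∧ eval₂ v ψ
eval₂ v (φ ⇒f ψ)  = not (eval₂ v φ) ∨ eval₂ v ψ
eval₂ v ⊥f        = false

-- O(φ,n): assignments μ (determined by values of x₁…xₙ) with μ(φ) = 1
O : ∀ {n} → Form n → Set
O {n} φ = Σ (Fin n → Bool) λ v → eval₂ v φ ≡ true

_≈O_ : ∀ {n} {φ : Form n} → O φ → O φ → Set
_≈O_ a b = ∀ i → proj₁ a i ≡ proj₁ b i

_≈M_ : ∀ {n} {φ : Form n} → MinBelow φ → MinBelow φ → Set₁
_≈M_ g h = proj₁ g ≡NM proj₁ h

Bijection-O-Min : ∀ {n} → Form n → Set₁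
Bijection-O-Min φ = Σ (O φ → MinBelow φ) λ f →
    (∀ a b → _≈O_ {φ = φ} a b → _≈M_ {φ = φ} (f a) (f b))
  × (∀ a b → _≈M_ {φ = φ} (f a) (f b) → _≈O_ {φ = φ} a b)
  × (∀ g → Σ (O φ) λ a → _≈M_ {φ = φ} (f a) g)

module Submission where

-- For an assignment v of truth values to x₁ … xₙ let g_v be the product of
-- literals  ⊙ᵢ ℓᵢ  with ℓᵢ = xᵢ² if v(xᵢ) = 1 and ℓᵢ = (¬xᵢ)² otherwise.  The
-- bijection sends v to [g_v].
--
-- Injectivity: g_v is true exactly at v in the two-element chain.

open import Defs
open import Level using (0ℓ)
open import Data.Nat using (ℕ; _≥_)
open import Data.Fin using (Fin)
open import Data.Bool using (Bool; true; false; _∧_; _∨_; not)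
open import Data.Bool.Properties using (∨-∧-isLattice; ∧-isCommutativeMonoid)
open import Data.List using (List; []; _∷_; allFin)
open import Data.List.Relation.Unary.Any using (here; there)
open import Data.List.Membership.Propositional using (_∈_)
open import Data.List.Membership.Propositional.Properties using (∈-allFin)
open import Data.Product using (Σ; _×_; proj₁; proj₂; _,_)
open import Data.Sum using (_⊎_; inj₁; inj₂) renaming (map to ⊎-map)
open import Data.Empty using (⊥-elim)
open import Relation.Nullary using (¬_)
open import Relation.Binary.PropositionalEquality
  using (_≡_; refl; sym; cong; cong₂; subst; subst₂)
open import Relation.Binary.Structures using (IsEquivalence; IsPartialOrder)
open import Relation.Binary.Bundles using (Poset)
import Relation.Binary.Lattice as OrderLattice
import Relation.Binary.Reasoning.PartialOrder as PosetReasoning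
open import Algebra.Bundles using (CommutativeSemigroup)
open import Algebra.Structures using (IsCommutativeMonoid)
open import Algebra.Lattice.Bundles using (Lattice)
open import Algebra.Lattice.Structures using (IsLattice)
import Algebra.Lattice.Properties.Lattice as LatticeProperties
import Algebra.Properties.CommutativeSemigroup as CommutativeSemigroupProperties

private
  variable
    n : ℕ
    φ ψ h : Form n

module NMProperties (A : NMAlgebra) where
  open NMAlgebra A public
    renaming (_≈_ to infix 4 _≈_; _≤_ to infix 4 _≤_; _⊓_ to infixr 7 _⊓_)
  open IsEquivalence (IsLattice.isEquivalence isLattice) public
    using () renaming (refl to ≈-refl; sym to ≈-sym)
  open IsCommutativeMonoid isCommMonoid public using ()
    renaming (assoc to ⊙-assoc; comm to ⊙-comm; identityˡ to ⊙-identityˡ;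
              identityʳ to ⊙-identityʳ; ∙-cong to ⊙-cong; isCommutativeSemigroup to ⊙-isCommutativeSemigroup)

  private
    lattice : Lattice 0ℓ 0ℓ
    lattice = record
      { Carrier = Carrier ; _≈_ = _≈_ ; _∨_ = _⊔_ ; _∧_ = _⊓_ ; isLattice = isLattice }
    open LatticeProperties lattice using (∧-idem)
    open OrderLattice.IsLattice (LatticeProperties.∨-∧-isOrderTheoreticLattice lattice)
      using (supremum; infimum) renaming (isPartialOrder to naturalOrder)
    module Natural = IsPartialOrder naturalOrder
    ⊙-semigroup : CommutativeSemigroup 0ℓ 0ℓ
    ⊙-semigroup = record
      { Carrier = Carrier ; _≈_ = _≈_ ; _∙_ = _⊙_
      ; isCommutativeSemigroup = ⊙-isCommutativeSemigroup }
    open CommutativeSemigroupProperties ⊙-semigroup using (interchange)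

  -- x ≤ y  (x ⊓ y ≈ x)  is the library's natural lattice order x ≈ x ⊓ y read
  -- backwards, so it inherits the partial-order laws and meets/joins.
  ≤-isPartialOrder : IsPartialOrder _≈_ _≤_
  ≤-isPartialOrder = record
    { isPreorder = record
      { isEquivalence = IsLattice.isEquivalence isLattice
      ; reflexive = λ x≈y → ≈-sym (Natural.reflexive x≈y)
      ; trans = λ x≤y y≤z → ≈-sym (Natural.trans (≈-sym x≤y) (≈-sym y≤z))
      }
    ; antisym = λ x≤y y≤x → Natural.antisym (≈-sym x≤y) (≈-sym y≤x)
    }

  poset : Poset 0ℓ 0ℓ 0ℓ
  poset = record { Carrier = Carrier ; _≈_ = _≈_ ; _≤_ = _≤_ ; isPartialOrder = ≤-isPartialOrder }

  open IsPartialOrder ≤-isPartialOrder public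
    using (reflexive; antisym) renaming (refl to ≤-refl; trans to ≤-trans)
  open PosetReasoning poset public

  x⊓y≤x : ∀ {x y} → x ⊓ y ≤ x
  x⊓y≤x {x} {y} = ≈-sym (proj₁ (infimum x y))

  x⊓y≤y : ∀ {x y} → x ⊓ y ≤ y
  x⊓y≤y {x} {y} = ≈-sym (proj₁ (proj₂ (infimum x y)))

  ⊓-greatest : ∀ {x y z} → z ≤ x → z ≤ y → z ≤ x ⊓ y
  ⊓-greatest {x} {y} {z} z≤x z≤y = ≈-sym (proj₂ (proj₂ (infimum x y)) z (≈-sym z≤x) (≈-sym z≤y))

  ⊔-least : ∀ {x y z} → x ≤ z → y ≤ z → (x ⊔ y) ≤ z
  ⊔-least {x} {y} {z} x≤z y≤z = ≈-sym (proj₂ (proj₂ (supremum x y)) z (≈-sym x≤z) (≈-sym y≤z))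

  ⊥≤ : ∀ {x} → ⊥ ≤ x
  ⊥≤ {x} = ⊥-least x

  ≤⊤ : ∀ {x} → x ≤ ⊤
  ≤⊤ {x} = ⊤-greatest x

  curry : ∀ {x y z} → x ⊙ y ≤ z → x ≤ (y ⇒ z)
  curry = residuation₁ _ _ _

  uncurry : ∀ {x y z} → x ≤ (y ⇒ z) → x ⊙ y ≤ z
  uncurry = residuation₂ _ _ _

  ⊙-monoˡ : ∀ {x y z} → x ≤ y → x ⊙ z ≤ y ⊙ z
  ⊙-monoˡ x≤y = uncurry (≤-trans x≤y (curry ≤-refl))

  ⊙-monoʳ : ∀ {x y z} → x ≤ y → z ⊙ x ≤ z ⊙ y
  ⊙-monoʳ {x} {y} {z} x≤y = begin
    z ⊙ x  ≈⟨ ⊙-comm z x ⟩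
    x ⊙ z  ≤⟨ ⊙-monoˡ x≤y ⟩
    y ⊙ z  ≈⟨ ⊙-comm y z ⟩
    z ⊙ y  ∎

  ⊙-mono : ∀ {x y u w} → x ≤ y → u ≤ w → x ⊙ u ≤ y ⊙ w
  ⊙-mono x≤y u≤w = ≤-trans (⊙-monoˡ x≤y) (⊙-monoʳ u≤w)

  x⊙y≤x : ∀ {x y} → x ⊙ y ≤ x
  x⊙y≤x {x} = ≤-trans (⊙-monoʳ ≤⊤) (reflexive (⊙-identityʳ x))

  x⊙y≤y : ∀ {x y} → x ⊙ y ≤ y
  x⊙y≤y {x} {y} = ≤-trans (reflexive (⊙-comm x y)) x⊙y≤x

  modus-ponens : ∀ {x y} → x ⊙ (x ⇒ y) ≤ y
  modus-ponens {x} {y} = ≤-trans (reflexive (⊙-comm x (x ⇒ y))) (uncurry ≤-refl)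

  internalise : ∀ {x y} → x ≤ y → ⊤ ≤ (x ⇒ y)
  internalise {x} x≤y = curry (≤-trans (reflexive (⊙-identityˡ x)) x≤y)

  externalise : ∀ {x y} → ⊤ ≤ (x ⇒ y) → x ≤ y
  externalise {x} ⊤≤x⇒y = ≤-trans (reflexive (≈-sym (⊙-identityˡ x))) (uncurry ⊤≤x⇒y)

  -- a is idempotent: a ≤ a ⊙ a (the converse a ⊙ a ≤ a always holds).
  IsIdem : Carrier → Set
  IsIdem a = a ≤ a ⊙ a

  idem-⊙ : ∀ {a b} → IsIdem a → IsIdem b → IsIdem (a ⊙ b)
  idem-⊙ {a} {b} a≤aa b≤bb = begin
    a ⊙ b              ≤⟨ ⊙-mono a≤aa b≤bb ⟩
    (a ⊙ a) ⊙ (b ⊙ b)  ≈⟨ interchange a a b b ⟩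
    (a ⊙ b) ⊙ (a ⊙ b)  ∎

  idem-valid : ∀ {a} → ⊤ ≤ a → IsIdem a
  idem-valid ⊤≤a = ≤-trans ≤⊤ (≤-trans (reflexive (≈-sym (⊙-identityˡ ⊤))) (⊙-mono ⊤≤a ⊤≤a))

  -- The NM axiom at (x, x) gives x² ≤ x³.
  square≤cube : ∀ x → x ² ≤ x ² ⊙ x
  square≤cube x = externalise (begin
    ⊤                                   ≈⟨ ≈-sym (nm-axiom x x) ⟩
    (∼ (x ²)) ⊔ ((x ⊓ x) ⇒ x ²)         ≤⟨ ⊔-least negated implied ⟩
    (x ² ⇒ x ² ⊙ x)                     ∎)
    where
    negated : ∼ (x ²) ≤ (x ² ⇒ x ² ⊙ x)
    negated = curry (≤-trans (reflexive (⊙-comm _ _)) (≤-trans modus-ponens ⊥≤))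
    implied : ((x ⊓ x) ⇒ x ²) ≤ (x ² ⇒ x ² ⊙ x)
    implied = curry (begin
      ((x ⊓ x) ⇒ x ²) ⊙ (x ⊙ x)  ≈⟨ ⊙-cong (⇒-cong (∧-idem x) ≈-refl) ≈-refl ⟩
      (x ⇒ x ²) ⊙ (x ⊙ x)        ≈⟨ ≈-sym (⊙-assoc _ x x) ⟩
      ((x ⇒ x ²) ⊙ x) ⊙ x        ≤⟨ ⊙-monoˡ (uncurry ≤-refl) ⟩
      x ² ⊙ x                    ∎)

  square-idem : ∀ x → IsIdem (x ²)
  square-idem x = begin
    x ²              ≤⟨ square≤cube x ⟩
    x ² ⊙ x          ≤⟨ ⊙-monoˡ (square≤cube x) ⟩
    (x ² ⊙ x) ⊙ x    ≈⟨ ⊙-assoc (x ²) x x ⟩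
    x ² ⊙ x ²        ∎

  squares-clash : ∀ x → x ² ⊙ (∼ x) ² ≤ ⊥
  squares-clash x = ≤-trans (⊙-mono x⊙y≤x x⊙y≤x) modus-ponens

  -- The NM⁻ axiom: an idempotent k annihilating both x² and (∼x)² is ⊥.
  -- With a = ∼(x²), b = ∼((∼x)²) we get k ≤ a², k ≤ b² and b² ≤ ∼(a²).
  idem-annihilating-squares : IsNM⁻ A → ∀ {k x} → IsIdem k →
    k ⊙ x ² ≤ ⊥ → k ⊙ (∼ x) ² ≤ ⊥ → k ≤ ⊥
  idem-annihilating-squares nm⁻ {k} {x} k-idem kx²≤⊥ k∼x²≤⊥ = begin
    k                   ≤⟨ k-idem ⟩
    k ⊙ k               ≤⟨ ⊙-mono k≤a² (≤-trans k≤b² b²≤∼a²) ⟩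
    (a ²) ⊙ ∼ (a ²)     ≤⟨ modus-ponens ⟩
    ⊥                   ∎
    where
    a b : Carrier
    a = ∼ (x ²)
    b = ∼ ((∼ x) ²)
    k≤a² : k ≤ a ²
    k≤a² = ≤-trans k-idem (⊙-mono (curry kx²≤⊥) (curry kx²≤⊥))
    k≤b² : k ≤ b ²
    k≤b² = ≤-trans k-idem (⊙-mono (curry k∼x²≤⊥) (curry k∼x²≤⊥))
    b²≤∼a² : b ² ≤ ∼ (a ²)
    b²≤∼a² = externalise (≤-trans (reflexive (≈-sym (nm⁻ x))) x⊙y≤y)

-- The semantic order on formulas: ⟦φ⟧ ≤ ⟦ψ⟧ in every NM⁻ algebra under every
-- valuation.  It is the order of NM⁻ₙ, but easier to compose.
record _⊑_ {n} (φ ψ : Form n) : Set₁ where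
  constructor holds
  field
    ⊑-at : (A : NMAlgebra) → IsNM⁻ A → (ρ : Fin n → NMAlgebra.Carrier A) →
           NMAlgebra._≤_ A (NMAlgebra.⟦_⟧ A φ ρ) (NMAlgebra.⟦_⟧ A ψ ρ)
open _⊑_

⊑-refl : φ ⊑ φ
⊑-refl = holds λ A _ _ → NMProperties.≤-refl A

⊑-trans : φ ⊑ ψ → ψ ⊑ h → φ ⊑ h
⊑-trans p q = holds λ A nm⁻ ρ → NMProperties.≤-trans A (⊑-at p A nm⁻ ρ) (⊑-at q A nm⁻ ρ)

⊥f-least : ⊥f ⊑ φ
⊥f-least = holds λ A _ _ → NMProperties.⊥≤ A

⊑-antisym : φ ⊑ ψ → ψ ⊑ φ → φ ≡NM ψ
⊑-antisym p q A nm⁻ ρ = antisym ≤⊤ (begin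
  ⊤            ≈⟨ ≈-sym (⊙-identityˡ ⊤) ⟩
  ⊤ ⊙ ⊤        ≤⟨ ⊙-mono (internalise (⊑-at p A nm⁻ ρ)) (internalise (⊑-at q A nm⁻ ρ)) ⟩
  _            ∎)
  where open NMProperties A

≡NM⇒⊑ : φ ≡NM ψ → φ ⊑ ψ
≡NM⇒⊑ e = holds λ A nm⁻ ρ → let open NMProperties A in
  externalise (≤-trans (reflexive (≈-sym (e A nm⁻ ρ))) x⊙y≤x)

≡NM⇒⊒ : φ ≡NM ψ → ψ ⊑ φ
≡NM⇒⊒ e = holds λ A nm⁻ ρ → let open NMProperties A in
  externalise (≤-trans (reflexive (≈-sym (e A nm⁻ ρ))) x⊙y≤y)

≡NM-refl : φ ≡NM φ
≡NM-refl {φ = φ} = ⊑-antisym {φ = φ} ⊑-refl ⊑-refl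

⊙f-lowerˡ : (φ ⊙f ψ) ⊑ φ
⊙f-lowerˡ = holds λ A _ _ → NMProperties.x⊙y≤x A

⊙f-lowerʳ : (φ ⊙f ψ) ⊑ ψ
⊙f-lowerʳ = holds λ A _ _ → NMProperties.x⊙y≤y A

∧f-lowerˡ : (φ ∧f ψ) ⊑ φ
∧f-lowerˡ = holds λ A _ _ → NMProperties.x⊓y≤x A

∧f-lowerʳ : (φ ∧f ψ) ⊑ ψ
∧f-lowerʳ = holds λ A _ _ → NMProperties.x⊓y≤y A

∧f-greatest : h ⊑ φ → h ⊑ ψ → h ⊑ (φ ∧f ψ)
∧f-greatest p q = holds λ A nm⁻ ρ → NMProperties.⊓-greatest A (⊑-at p A nm⁻ ρ) (⊑-at q A nm⁻ ρ)

≤NM⇒⊑ : φ ≤NM ψ → φ ⊑ ψ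
≤NM⇒⊑ {φ = φ} {ψ} φ∧ψ≡φ = ⊑-trans (≡NM⇒⊒ {φ = φ ∧f ψ} {ψ = φ} φ∧ψ≡φ) ∧f-lowerʳ

⊑⇒≤NM : φ ⊑ ψ → φ ≤NM ψ
⊑⇒≤NM φ⊑ψ = ⊑-antisym ∧f-lowerˡ (∧f-greatest ⊑-refl φ⊑ψ)

twoChain : NMAlgebra
twoChain = record
  { Carrier = Bool ; _≈_ = _≡_ ; _⊓_ = _∧_ ; _⊔_ = _∨_ ; _⊙_ = _∧_
  ; _⇒_ = λ a b → not a ∨ b ; ⊥ = false ; ⊤ = true
  ; isLattice = ∨-∧-isLattice
  ; ⊥-least = λ _ → refl
  ; ⊤-greatest = λ { true → refl ; false → refl }
  ; isCommMonoid = ∧-isCommutativeMonoid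
  ; ⇒-cong = λ { refl refl → refl }
  ; residuation₁ = λ { false _ _ _ → refl ; true false _ _ → refl ; true true true _ → refl }
  ; residuation₂ = λ { false _ _ _ → refl ; true false _ _ → refl ; true true true _ → refl }
  ; prelinearity = λ { true true → refl ; true false → refl ; false _ → refl }
  ; nm-axiom = λ { true true → refl ; true false → refl ; false _ → refl }
  ; involution = λ { true → refl ; false → refl }
  }

twoChain-NM⁻ : IsNM⁻ twoChain
twoChain-NM⁻ true = refl
twoChain-NM⁻ false = refl

⟦⟧-twoChain : (v : Fin n → Bool) (φ : Form n) → NMAlgebra.⟦_⟧ twoChain φ v ≡ eval₂ v φ
⟦⟧-twoChain v (var i) = refl
⟦⟧-twoChain v (φ ⊙f ψ) = cong₂ _∧_ (⟦⟧-twoChain v φ) (⟦⟧-twoChain v ψ)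
⟦⟧-twoChain v (φ ∧f ψ) = cong₂ _∧_ (⟦⟧-twoChain v φ) (⟦⟧-twoChain v ψ)
⟦⟧-twoChain v (φ ⇒f ψ) = cong₂ (λ a b → not a ∨ b) (⟦⟧-twoChain v φ) (⟦⟧-twoChain v ψ)
⟦⟧-twoChain v ⊥f = refl

⊑-true : φ ⊑ ψ → (v : Fin _ → Bool) → eval₂ v φ ≡ true → eval₂ v ψ ≡ true
⊑-true {φ = φ} {ψ} φ⊑ψ v φ-true =
  subst (λ a → (a ∧ eval₂ v ψ) ≡ a) φ-true
    (subst₂ (λ a b → (a ∧ b) ≡ a) (⟦⟧-twoChain v φ) (⟦⟧-twoChain v ψ)
      (⊑-at φ⊑ψ twoChain twoChain-NM⁻ v))

neg : Form n → Form n
neg φ = φ ⇒f ⊥f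

⊤f : Form n
⊤f = ⊥f ⇒f ⊥f

lit : Bool → Fin n → Form n
lit true i = var i ⊙f var i
lit false i = neg (var i) ⊙f neg (var i)

Gl : (Fin n → Bool) → List (Fin n) → Form n
Gl v [] = ⊤f
Gl v (i ∷ is) = lit (v i) i ⊙f Gl v is

G : (Fin n → Bool) → Form n
G {n} v = Gl v (allFin n)

G-cong : {v w : Fin n → Bool} → (∀ i → v i ≡ w i) → G v ≡ G w
G-cong {n} {v} {w} v≗w = Gl-cong (allFin n)
  where
  Gl-cong : ∀ is → Gl v is ≡ Gl w is
  Gl-cong [] = refl
  Gl-cong (i ∷ is) = cong₂ _⊙f_ (cong (λ b → lit b i) (v≗w i)) (Gl-cong is)

lit-true : (w : Fin n → Bool) (b : Bool) (i : Fin n) → w i ≡ b → eval₂ w (lit b i) ≡ true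
lit-true w true i wi≡b = cong (λ a → a ∧ a) wi≡b
lit-true w false i wi≡b = cong (λ a → (not a ∨ false) ∧ (not a ∨ false)) wi≡b

lit-true⁻ : (w : Fin n → Bool) (b : Bool) (i : Fin n) → eval₂ w (lit b i) ≡ true → w i ≡ b
lit-true⁻ w true i e with w i
... | true = refl
... | false = e
lit-true⁻ w false i e with w i
... | true = sym e
... | false = refl

G-self : (v : Fin n → Bool) → eval₂ v (G v) ≡ true
G-self {n} v = Gl-self (allFin n)
  where
  Gl-self : ∀ is → eval₂ v (Gl v is) ≡ true
  Gl-self [] = refl
  Gl-self (i ∷ is) = cong₂ _∧_ (lit-true v (v i) i refl) (Gl-self is)

G-true⁻ : (v w : Fin n → Bool) → eval₂ w (G v) ≡ true → ∀ i → w i ≡ v i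
G-true⁻ {n} v w w-true i = Gl-true⁻ (allFin n) w-true (∈-allFin i)
  where
  ∧-true : ∀ {a b} → (a ∧ b) ≡ true → (a ≡ true) × (b ≡ true)
  ∧-true {true} {true} _ = refl , refl
  Gl-true⁻ : ∀ is → eval₂ w (Gl v is) ≡ true → ∀ {i} → i ∈ is → w i ≡ v i
  Gl-true⁻ (j ∷ is) e (here refl) = lit-true⁻ w (v j) j (proj₁ (∧-true e))
  Gl-true⁻ (j ∷ is) e (there i∈is) = Gl-true⁻ is (proj₂ (∧-true e)) i∈is

module Literals (A : NMAlgebra) {n : ℕ} (ρ : Fin n → NMAlgebra.Carrier A) where
  open NMProperties A

  ⊤≤⟦⊤f⟧ : ⊤ ≤ ⟦ ⊤f {n} ⟧ ρ
  ⊤≤⟦⊤f⟧ = internalise ≤-refl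

  lit-idem : ∀ b i → IsIdem (⟦ lit b i ⟧ ρ)
  lit-idem true i = square-idem (ρ i)
  lit-idem false i = square-idem (∼ ρ i)

  lit-clash : ∀ b i → ⟦ lit b i ⟧ ρ ⊙ ⟦ lit (not b) i ⟧ ρ ≤ ⊥
  lit-clash true i = squares-clash (ρ i)
  lit-clash false i = ≤-trans (reflexive (⊙-comm _ _)) (squares-clash (ρ i))

  Gl-idem : ∀ v is → IsIdem (⟦ Gl v is ⟧ ρ)
  Gl-idem v [] = idem-valid ⊤≤⟦⊤f⟧
  Gl-idem v (i ∷ is) = idem-⊙ (lit-idem (v i) i) (Gl-idem v is)

  Gl-below-lit : ∀ v is {i} → i ∈ is → ⟦ Gl v is ⟧ ρ ≤ ⟦ lit (v i) i ⟧ ρ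
  Gl-below-lit v (j ∷ is) (here refl) = x⊙y≤x
  Gl-below-lit v (j ∷ is) (there i∈is) = ≤-trans x⊙y≤y (Gl-below-lit v is i∈is)

  G-idem : ∀ v → IsIdem (⟦ G v ⟧ ρ)
  G-idem v = Gl-idem v (allFin n)

  G-below-lit : ∀ v i → ⟦ G v ⟧ ρ ≤ ⟦ lit (v i) i ⟧ ρ
  G-below-lit v i = Gl-below-lit v (allFin n) (∈-allFin i)

  annihilating-G : IsNM⁻ A → ∀ v is {k} → IsIdem k → k ⊙ ⟦ Gl v is ⟧ ρ ≤ ⊥ →
    (∀ {i} → i ∈ is → k ⊙ ⟦ lit (not (v i)) i ⟧ ρ ≤ ⊥) → k ≤ ⊥
  annihilating-G nm⁻ v [] {k} _ kG≤⊥ _ = begin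
    k                ≈⟨ ≈-sym (⊙-identityʳ k) ⟩
    k ⊙ ⊤            ≤⟨ ⊙-monoʳ ⊤≤⟦⊤f⟧ ⟩
    k ⊙ ⟦ ⊤f ⟧ ρ     ≤⟨ kG≤⊥ ⟩
    ⊥                ∎
  annihilating-G nm⁻ v (i ∷ is) {k} k-idem kG≤⊥ opposite =
    both-literals (v i) kℓ≤⊥ (opposite (here refl))
    where
    ℓ : Carrier
    ℓ = ⟦ lit (v i) i ⟧ ρ
    kℓ≤⊥ : k ⊙ ℓ ≤ ⊥
    kℓ≤⊥ = annihilating-G nm⁻ v is (idem-⊙ k-idem (lit-idem (v i) i))
      (≤-trans (reflexive (⊙-assoc k ℓ _)) kG≤⊥)
      (λ j∈is → ≤-trans (⊙-monoˡ x⊙y≤x) (opposite (there j∈is)))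
    both-literals : ∀ b → k ⊙ ⟦ lit b i ⟧ ρ ≤ ⊥ → k ⊙ ⟦ lit (not b) i ⟧ ρ ≤ ⊥ → k ≤ ⊥
    both-literals true  p q = idem-annihilating-squares nm⁻ k-idem p q
    both-literals false p q = idem-annihilating-squares nm⁻ k-idem q p

module Evaluation (A : NMAlgebra) {n : ℕ} (ρ : Fin n → NMAlgebra.Carrier A)
                  (v : Fin n → Bool) (g : NMAlgebra.Carrier A)
                  (g-idem : NMProperties.IsIdem A g)
                  (g-below-lit : ∀ i → NMAlgebra._≤_ A g (NMAlgebra.⟦_⟧ A (lit (v i) i) ρ)) where
  open NMProperties A

  Verdict : Form n → Bool → Set
  Verdict ψ true = g ≤ ⟦ ψ ⟧ ρ
  Verdict ψ false = g ⊙ ⟦ ψ ⟧ ρ ≤ ⊥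

  var-verdict : ∀ i b → g ≤ ⟦ lit b i ⟧ ρ → Verdict (var i) b
  var-verdict i true g≤x² = ≤-trans g≤x² x⊙y≤x
  var-verdict i false g≤∼x² = begin
    g ⊙ ρ i                ≤⟨ ⊙-monoˡ g≤∼x² ⟩
    (∼ ρ i ⊙ ∼ ρ i) ⊙ ρ i  ≈⟨ ⊙-assoc _ _ _ ⟩
    ∼ ρ i ⊙ (∼ ρ i ⊙ ρ i)  ≤⟨ x⊙y≤y ⟩
    ∼ ρ i ⊙ ρ i            ≈⟨ ⊙-comm _ _ ⟩
    ρ i ⊙ ∼ ρ i            ≤⟨ modus-ponens ⟩
    ⊥                      ∎

  ⊙-verdict : ∀ ψ₁ ψ₂ b₁ b₂ → Verdict ψ₁ b₁ → Verdict ψ₂ b₂ → Verdict (ψ₁ ⊙f ψ₂) (b₁ ∧ b₂)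
  ⊙-verdict ψ₁ ψ₂ true true g≤a₁ g≤a₂ = ≤-trans g-idem (⊙-mono g≤a₁ g≤a₂)
  ⊙-verdict ψ₁ ψ₂ true false _ ga₂≤⊥ = ≤-trans (⊙-monoʳ x⊙y≤y) ga₂≤⊥
  ⊙-verdict ψ₁ ψ₂ false _ ga₁≤⊥ _ =
    ≤-trans (reflexive (≈-sym (⊙-assoc _ _ _))) (≤-trans x⊙y≤x ga₁≤⊥)

  ∧-verdict : ∀ ψ₁ ψ₂ b₁ b₂ → Verdict ψ₁ b₁ → Verdict ψ₂ b₂ → Verdict (ψ₁ ∧f ψ₂) (b₁ ∧ b₂)
  ∧-verdict ψ₁ ψ₂ true true g≤a₁ g≤a₂ = ⊓-greatest g≤a₁ g≤a₂
  ∧-verdict ψ₁ ψ₂ true false _ ga₂≤⊥ = ≤-trans (⊙-monoʳ x⊓y≤y) ga₂≤⊥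
  ∧-verdict ψ₁ ψ₂ false _ ga₁≤⊥ _ = ≤-trans (⊙-monoʳ x⊓y≤x) ga₁≤⊥

  ⇒-verdict : ∀ ψ₁ ψ₂ b₁ b₂ → Verdict ψ₁ b₁ → Verdict ψ₂ b₂ → Verdict (ψ₁ ⇒f ψ₂) (not b₁ ∨ b₂)
  ⇒-verdict ψ₁ ψ₂ false _ ga₁≤⊥ _ = curry (≤-trans ga₁≤⊥ ⊥≤)
  ⇒-verdict ψ₁ ψ₂ true true _ g≤a₂ = ≤-trans g≤a₂ (curry x⊙y≤x)
  ⇒-verdict ψ₁ ψ₂ true false g≤a₁ ga₂≤⊥ = begin
    g ⊙ (a₁ ⇒ a₂)          ≤⟨ ⊙-monoˡ (≤-trans g-idem (⊙-monoʳ g≤a₁)) ⟩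
    (g ⊙ a₁) ⊙ (a₁ ⇒ a₂)   ≈⟨ ⊙-assoc _ _ _ ⟩
    g ⊙ (a₁ ⊙ (a₁ ⇒ a₂))   ≤⟨ ⊙-monoʳ modus-ponens ⟩
    g ⊙ a₂                 ≤⟨ ga₂≤⊥ ⟩
    ⊥                      ∎
    where
    a₁ a₂ : Carrier
    a₁ = ⟦ ψ₁ ⟧ ρ
    a₂ = ⟦ ψ₂ ⟧ ρ

  verdict : ∀ ψ → Verdict ψ (eval₂ v ψ)
  verdict (var i) = var-verdict i (v i) (g-below-lit i)
  verdict (ψ₁ ⊙f ψ₂) = ⊙-verdict ψ₁ ψ₂ (eval₂ v ψ₁) (eval₂ v ψ₂) (verdict ψ₁) (verdict ψ₂)
  verdict (ψ₁ ∧f ψ₂) = ∧-verdict ψ₁ ψ₂ (eval₂ v ψ₁) (eval₂ v ψ₂) (verdict ψ₁) (verdict ψ₂)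
  verdict (ψ₁ ⇒f ψ₂) = ⇒-verdict ψ₁ ψ₂ (eval₂ v ψ₁) (eval₂ v ψ₂) (verdict ψ₁) (verdict ψ₂)
  verdict ⊥f = x⊙y≤y

module G-Evaluation (A : NMAlgebra) {n : ℕ} (ρ : Fin n → NMAlgebra.Carrier A) (v : Fin n → Bool) =
  Evaluation A ρ v (NMAlgebra.⟦_⟧ A (G v) ρ) (Literals.G-idem A ρ v) (Literals.G-below-lit A ρ v)

G-below-true : (v : Fin n → Bool) (ψ : Form n) → eval₂ v ψ ≡ true → G v ⊑ ψ
G-below-true v ψ ψ-true = holds λ A _ ρ →
  subst (G-Evaluation.Verdict A ρ v ψ) ψ-true (G-Evaluation.verdict A ρ v ψ)

G-annihilates-false : (v : Fin n → Bool) (ψ : Form n) → eval₂ v ψ ≡ false → (G v ⊙f ψ) ⊑ ⊥f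
G-annihilates-false v ψ ψ-false = holds λ A _ ρ →
  subst (G-Evaluation.Verdict A ρ v ψ) ψ-false (G-Evaluation.verdict A ρ v ψ)

Compatible : Form n → (Fin n → Bool) → Set₁
Compatible h v = ∀ i → (h ⊙f lit (not (v i)) i) ⊑ ⊥f

idem-semantic : Idempotent h → h ⊑ (h ⊙f h)
idem-semantic {h = h} = ≡NM⇒⊒ {φ = h ⊙f h} {ψ = h}

compatible-true : {v : Fin n → Bool} → Idempotent h → ¬ (h ≡NM ⊥f) → Compatible h v → eval₂ v h ≡ true
compatible-true {n} {h} {v} h-idem h≢⊥ compatible with eval₂ v h in h-value
... | true = refl
... | false = ⊥-elim (h≢⊥ (⊑-antisym h⊑⊥ ⊥f-least))
  where
  h⊑⊥ : h ⊑ ⊥f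
  h⊑⊥ = holds λ A nm⁻ ρ → let open NMProperties A in
    Literals.annihilating-G A ρ nm⁻ v (allFin n) (⊑-at (idem-semantic {h = h} h-idem) A nm⁻ ρ)
      (≤-trans (reflexive (⊙-comm _ _)) (⊑-at (G-annihilates-false v h h-value) A nm⁻ ρ))
      (λ {i} _ → ⊑-at (compatible i) A nm⁻ ρ)

G-idempotent : (v : Fin n → Bool) → Idempotent (G v)
G-idempotent v = ⊑-antisym (⊙f-lowerˡ {φ = G v} {ψ = G v}) (holds λ A _ ρ → Literals.G-idem A ρ v)

G-nonzero : (v : Fin n → Bool) → ¬ (G v ≡NM ⊥f)
G-nonzero v G≡⊥ with ⊑-true (≡NM⇒⊑ {φ = G v} {ψ = ⊥f} G≡⊥) v (G-self v)
... | ()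

-- An upper bound of y and z which the two-element chain evaluates as y ∨ z.
upper : Form n → Form n → Form n
upper y z = ((y ⇒f z) ⇒f z) ∧f ((z ⇒f y) ⇒f y)

upper-boundˡ : (y z : Form n) → y ⊑ upper y z
upper-boundˡ y z = holds λ A _ _ → let open NMProperties A in
  ⊓-greatest (curry modus-ponens) (curry x⊙y≤x)

upper-boundʳ : (y z : Form n) → z ⊑ upper y z
upper-boundʳ y z = holds λ A _ _ → let open NMProperties A in
  ⊓-greatest (curry x⊙y≤x) (curry modus-ponens)

upper-true : (v : Fin n → Bool) (y z : Form n) → eval₂ v (upper y z) ≡ true →
  (eval₂ v y ≡ true) ⊎ (eval₂ v z ≡ true)
upper-true v y z = two-valued (eval₂ v y) (eval₂ v z)
  where
  two-valued : ∀ a b → ((not (not a ∨ b) ∨ b) ∧ (not (not b ∨ a) ∨ a)) ≡ true →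
    (a ≡ true) ⊎ (b ≡ true)
  two-valued true _ _ = inj₁ refl
  two-valued false true _ = inj₂ refl

-- If [g_v] = [y] ∨ [z] then g_v ≤ upper y z, so v makes y or z true and g_v
-- lies below that one.
G-joinIrreducible : (v : Fin n → Bool) → JoinIrreducible (G v)
G-joinIrreducible v = G-nonzero v , split
  where
  split : ∀ y z → IsJoinOf (G v) y z → (G v ≡NM y) ⊎ (G v ≡NM z)
  split y z (y≤G , z≤G , least) =
    ⊎-map (λ y-true → ⊑-antisym (G-below-true v y y-true) (≤NM⇒⊑ y≤G))
          (λ z-true → ⊑-antisym (G-below-true v z z-true) (≤NM⇒⊑ z≤G))
          (upper-true v y z (⊑-true G⊑upper v (G-self v)))
    where
    G⊑upper : G v ⊑ upper y z
    G⊑upper = ≤NM⇒⊑ (least (upper y z) (⊑⇒≤NM (upper-boundˡ y z)) (⊑⇒≤NM (upper-boundʳ y z)))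

G-IdemJI : (v : Fin n → Bool) → IdemJI (G v)
G-IdemJI v = G-idempotent v , G-joinIrreducible v

below-G-compatible : {v : Fin n → Bool} → h ⊑ G v → Compatible h v
below-G-compatible {v = v} h⊑G i = holds λ A nm⁻ ρ → let open NMProperties A in
  ≤-trans (⊙-monoˡ (≤-trans (⊑-at h⊑G A nm⁻ ρ) (Literals.G-below-lit A ρ v i)))
          (Literals.lit-clash A ρ (v i) i)

G-minimal : (v : Fin n → Bool) → MinIdemJI (G v)
G-minimal v = G-IdemJI v , minimal
  where
  minimal : ∀ h → IdemJI h → h ≤NM G v → h ≡NM G v
  minimal h (h-idem , h-ji) h≤G = ⊑-antisym h⊑G
    (G-below-true v h (compatible-true h-idem (proj₁ h-ji) (below-G-compatible h⊑G)))
    where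
    h⊑G : h ⊑ G v
    h⊑G = ≤NM⇒⊑ h≤G

prelinear-split : (h p q : Form n) → IsJoinOf h (h ⊙f (p ⇒f q)) (h ⊙f (q ⇒f p))
prelinear-split h p q =
  ⊑⇒≤NM (⊙f-lowerˡ {φ = h} {ψ = p ⇒f q}) , ⊑⇒≤NM (⊙f-lowerˡ {φ = h} {ψ = q ⇒f p}) ,
  λ w below₁ below₂ → ⊑⇒≤NM {φ = h} {ψ = w} (holds λ A nm⁻ ρ → let open NMProperties A in
    externalise (begin
      ⊤                                     ≈⟨ ≈-sym (prelinearity (⟦ p ⟧ ρ) (⟦ q ⟧ ρ)) ⟩
      (⟦ p ⟧ ρ ⇒ ⟦ q ⟧ ρ) ⊔ (⟦ q ⟧ ρ ⇒ ⟦ p ⟧ ρ)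
        ≤⟨ ⊔-least (curry (≤-trans (reflexive (⊙-comm _ _)) (⊑-at (≤NM⇒⊑ {φ = h ⊙f (p ⇒f q)} {ψ = w} below₁) A nm⁻ ρ)))
                   (curry (≤-trans (reflexive (⊙-comm _ _)) (⊑-at (≤NM⇒⊑ {φ = h ⊙f (q ⇒f p)} {ψ = w} below₂) A nm⁻ ρ))) ⟩
      (⟦ h ⟧ ρ ⇒ ⟦ w ⟧ ρ)                   ∎))

annihilates-square : h ⊑ (φ ⇒f neg φ) → (h ⊙f (φ ⊙f φ)) ⊑ ⊥f
annihilates-square h⊑x⇒¬x = holds λ A nm⁻ ρ → let open NMProperties A in
  ≤-trans (reflexive (≈-sym (⊙-assoc _ _ _))) (uncurry (uncurry (⊑-at h⊑x⇒¬x A nm⁻ ρ)))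

annihilates-neg-square : h ⊑ (neg φ ⇒f φ) → (h ⊙f (neg φ ⊙f neg φ)) ⊑ ⊥f
annihilates-neg-square h⊑¬x⇒x = holds λ A nm⁻ ρ → let open NMProperties A in
  ≤-trans (reflexive (≈-sym (⊙-assoc _ _ _)))
          (≤-trans (⊙-monoˡ (uncurry (⊑-at h⊑¬x⇒x A nm⁻ ρ))) modus-ponens)

-- Splitting along x_i → ¬x_i and ¬x_i → x_i, a join-irreducible h annihilates
-- x_i² or (¬x_i)²; b is the value of x_i whose literal is not annihilated.
annihilated-literal : (h : Form n) → JoinIrreducible h → ∀ i → Σ Bool λ b → (h ⊙f lit (not b) i) ⊑ ⊥f
annihilated-literal h (_ , split) i =
  choose (split (h ⊙f (var i ⇒f neg (var i))) (h ⊙f (neg (var i) ⇒f var i))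
                (prelinear-split h (var i) (neg (var i))))
  where
  choose : (h ≡NM (h ⊙f (var i ⇒f neg (var i)))) ⊎ (h ≡NM (h ⊙f (neg (var i) ⇒f var i))) →
    Σ Bool λ b → (h ⊙f lit (not b) i) ⊑ ⊥f
  choose (inj₁ h≡h⊙[x⇒¬x]) = false , annihilates-square (⊑-trans (≡NM⇒⊑ h≡h⊙[x⇒¬x]) (⊙f-lowerʳ {φ = h}))
  choose (inj₂ h≡h⊙[¬x⇒x]) = true , annihilates-neg-square (⊑-trans (≡NM⇒⊑ h≡h⊙[¬x⇒x]) (⊙f-lowerʳ {φ = h}))

compatible-assignment : (h : Form n) → JoinIrreducible h → Σ (Fin n → Bool) (Compatible h)
compatible-assignment h h-ji =
  (λ i → proj₁ (annihilated-literal h h-ji i)) , (λ i → proj₂ (annihilated-literal h h-ji i))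

minimal-is-G : (φ h : Form n) → MinIdemJI h → h ≤NM φ → Σ (O φ) λ a → G (proj₁ a) ≡NM h
minimal-is-G φ h ((h-idem , h-ji) , minimal) h≤φ = from-assignment (compatible-assignment h h-ji)
  where
  from-assignment : Σ (Fin _ → Bool) (Compatible h) → Σ (O φ) λ a → G (proj₁ a) ≡NM h
  from-assignment (v , compatible) =
    (v , ⊑-true (≤NM⇒⊑ {φ = h} {ψ = φ} h≤φ) v h-true) ,
    minimal (G v) (G-IdemJI v) (⊑⇒≤NM (G-below-true v h h-true))
    where
    h-true : eval₂ v h ≡ true
    h-true = compatible-true h-idem (proj₁ h-ji) compatible

lemma5 : (n : ℕ) → n ≥ 1 → (φ : Form n) → Bijection-O-Min φ
lemma5 n _ φ = toMin , well-defined , injective , surjective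
  where
  toMin : O φ → MinBelow φ
  toMin (v , φ-true) = G v , G-minimal v , ⊑⇒≤NM (G-below-true v φ φ-true)

  well-defined : ∀ a b → _≈O_ {φ = φ} a b → _≈M_ {φ = φ} (toMin a) (toMin b)
  well-defined (v , _) (w , _) v≗w = subst (G v ≡NM_) (G-cong v≗w) (≡NM-refl {φ = G v})

  injective : ∀ a b → _≈M_ {φ = φ} (toMin a) (toMin b) → _≈O_ {φ = φ} a b
  injective (v , _) (w , _) Gv≡Gw i = G-true⁻ w v (⊑-true (≡NM⇒⊑ {φ = G v} {ψ = G w} Gv≡Gw) v (G-self v)) i

  surjective : ∀ g → Σ (O φ) λ a → _≈M_ {φ = φ} (toMin a) g
  surjective (h , h-minimal , h≤φ) = minimal-is-G φ h h-minimal h≤φ
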